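{- If $G$ is a regular graph of odd degree, then $d_g(G)\le \frac{\delta(G)+1}{2}$, where $\delta(G)$ is the minimum degree of $G$.
   Context: All graphs are finite and simple. For a vertex $x$, $N[x]$ denotes its closed neighborhood. The domatic number game on $G$ with palette $[k]=\{1,\dots,k\}$: two players, Alice and Bob, alternately choose a previously unchosen vertex of $G$ and assign it a color from $[k]$, until every vertex has been colored. Let $V_i$ be the set of vertices colored $i$. Alice wins if every $V_i$ ($i\in[k]$) is a dominating set of $G$, i.e. for every vertex $x$ and every color $c\in[k]$ some vertex of $N[x]$ has color $c$; otherwise Bob wins. In the $A$-game Alice moves first. The game domatic number $d_g(G)$ is the largest $k$ for which Alice has a winning strategy in the $A$-game with palette $[k]$. -}

module Defs where

open import Data.Nat using (ℕ; zero; suc; _+_; _⊓_; _%_)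
open import Data.Bool using (Bool; true; false; if_then_else_)
open import Data.Fin using (Fin; zero; suc; _≟_)
open import Data.Maybe using (Maybe; just; nothing; is-just)
open import Data.Product using (Σ; ∃; _×_; _,_)
open import Data.Sum using (_⊎_)
open import Relation.Nullary using (¬_; does)
open import Relation.Binary.PropositionalEquality using (_≡_)

record Graph (n : ℕ) : Set where
  field
    adj    : Fin n → Fin n → Bool
    sym    : ∀ u v → adj u v ≡ adj v u
    irrefl : ∀ v → adj v v ≡ false
open Graph public

countF : ∀ {n} → (Fin n → Bool) → ℕ
countF {zero}  p = 0
countF {suc n} p = (if p zero then 1 else 0) + countF (λ i → p (suc i))

degree : ∀ {n} → Graph n → Fin n → ℕ
degree G v = countF (adj G v)

Regular : ∀ {n} → Graph n → ℕ → Set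
Regular G r = ∀ v → degree G v ≡ r

minF : ∀ {n} → (Fin (suc n) → ℕ) → ℕ
minF {zero}  f = f zero
minF {suc n} f = f zero ⊓ minF (λ i → f (suc i))

minDegree : ∀ {n} → Graph (suc n) → ℕ
minDegree G = minF (degree G)

-- Partial colourings with palette Fin k  (Fin k ≅ [k]); nothing = uncoloured.
Colouring : ℕ → ℕ → Set
Colouring n k = Fin n → Maybe (Fin k)

assign : ∀ {n k} → Colouring n k → Fin n → Fin k → Colouring n k
assign c v col w = if does (w ≟ v) then just col else c w

numColoured : ∀ {n k} → Colouring n k → ℕ
numColoured c = countF (λ v → is-just (c v))

AllColoured : ∀ {n k} → Colouring n k → Set
AllColoured c = ∀ v → is-just (c v) ≡ true

AllClassesDominating : ∀ {n k} → Graph n → Colouring n k → Set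
AllClassesDominating {n} {k} G c =
  ∀ (x : Fin n) (i : Fin k) → ∃ λ y → (y ≡ x ⊎ adj G x y ≡ true) × c y ≡ just i

AliceTurn : ∀ {n k} → Colouring n k → Set
AliceTurn c = numColoured c % 2 ≡ 0

BobTurn : ∀ {n k} → Colouring n k → Set
BobTurn c = numColoured c % 2 ≡ 1

data AliceWins {n : ℕ} (G : Graph n) (k : ℕ) : Colouring n k → Set where
  finished : ∀ {c} → AllColoured c → AllClassesDominating G c → AliceWins G k c
  aliceMove : ∀ {c} → AliceTurn c → (v : Fin n) → c v ≡ nothing → (i : Fin k) →
              AliceWins G k (assign c v i) → AliceWins G k c
  bobMove : ∀ {c} → BobTurn c → ¬ AllColoured c →
            (∀ (v : Fin n) → c v ≡ nothing → (i : Fin k) → AliceWins G k (assign c v i)) →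
            AliceWins G k c

emptyColouring : ∀ {n k} → Colouring n k
emptyColouring v = nothing

AliceWinsAGame : ∀ {n} → Graph n → ℕ → Set
AliceWinsAGame G k = AliceWins G k emptyColouring

module Submission where

-- Fix a vertex x of odd degree r. By the handshake lemma the order of an r-regular graph is even,
-- and so is |N[x]| = r + 1. Bob answers every move of Alice inside N[x] by colouring another
-- vertex of N[x] with a colour already present there, and every move outside N[x] by a move
-- outside N[x]; these parities guarantee that such a free vertex always exists. Thus each colour
-- new to N[x] is paid for by two coloured vertices of N[x], so at most (r + 1) / 2 colours ever
-- appear in N[x], and only those can dominate x.

open import Defs
open import Data.Nat using (ℕ; suc; _≤_; _+_; _/_; _%_)
open import Relation.Binary.PropositionalEquality using (_≡_)

open import Data.Bool as Bool using (Bool; true; false; not; _∧_; _∨_; T; if_then_else_)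
open import Data.Bool.Properties using (not-injective; ∧-comm; ∧-zeroʳ; ∧-identityʳ; ∨-zeroʳ)
open import Data.Empty using (⊥-elim)
open import Data.Fin using (Fin; zero; suc; _≟_)
open import Data.Fin.Properties using (any?; suc-injective)
open import Data.Maybe using (just; nothing; is-just; is-nothing)
open import Data.Maybe.Properties using (just-injective; ≡-dec)
open import Data.Nat using (zero; z≤n; s≤s; _*_; _⊓_; parity)
open import Data.Nat.DivMod using (%-distribˡ-+; m*n/n≡m; /-monoˡ-≤)
open import Data.Nat.Properties
  using (≤-refl; ≤-reflexive; ≤-trans; +-mono-≤; m≤n+m; +-suc; +-assoc; +-comm; +-identityʳ;
         *-suc; *-identityʳ; ⊓-idem; +-commutativeSemigroup; +-0-commutativeMonoid;
         module ≤-Reasoning)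
open import Algebra.Properties.CommutativeMonoid.Sum +-0-commutativeMonoid
  using (sum; ∑-distrib-+; sum-cong-≗)
open import Algebra.Properties.CommutativeSemigroup +-commutativeSemigroup using (interchange)
open import Data.Parity.Base as ℙ using (0ℙ; 1ℙ)
open import Data.Parity.Properties using (+-homo-+; *-homo-*; p+p≡0ℙ)
  renaming (*-identityʳ to ℙ-*-identityʳ)
open import Data.Product using (∃; _×_; _,_; proj₁)
open import Data.Sum as Sum using (_⊎_; inj₁; inj₂)
open import Function using (_∘_; case_of_)
open import Relation.Binary.PropositionalEquality as ≡
  using (_≢_; _≗_; refl; trans; cong; cong₂)
open import Relation.Nullary using (yes; no; does; _×-dec_; contradiction)
open import Relation.Nullary.Decidable using (⌊_⌋; toWitness; fromWitness)
open import Relation.Unary using (Decidable)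

indicator : Bool → ℕ
indicator b = if b then 1 else 0

indicator-mono : ∀ {a b : Bool} → (T a → T b) → indicator a ≤ indicator b
indicator-mono {false} _ = z≤n
indicator-mono {true} {true} _ = ≤-refl
indicator-mono {true} {false} a⇒b = ⊥-elim (a⇒b _)

countF-cong : ∀ {n} {p q : Fin n → Bool} → p ≗ q → countF p ≡ countF q
countF-cong {zero} _ = refl
countF-cong {suc n} p≗q =
  cong₂ (λ b m → indicator b + m) (p≗q zero) (countF-cong (p≗q ∘ suc))

countF-mono : ∀ {n} {p q : Fin n → Bool} → (∀ i → T (p i) → T (q i)) → countF p ≤ countF q
countF-mono {zero} _ = z≤n
countF-mono {suc n} p⊆q = +-mono-≤ (indicator-mono (p⊆q zero)) (countF-mono (p⊆q ∘ suc))

countF-≤-suc : ∀ {n} {p q : Fin n → Bool} (i : Fin n) →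
               (∀ j → T (q j) → T (p j) ⊎ j ≡ i) → countF q ≤ suc (countF p)
countF-≤-suc {suc n} {p} {q} zero q⊆p∪i = ≤-trans
  (+-mono-≤ (indicator-mono {q zero} {true} _) (countF-mono tail⊆))
  (s≤s (m≤n+m _ (indicator (p zero))))
  where
  tail⊆ : ∀ j → T (q (suc j)) → T (p (suc j))
  tail⊆ j qj with q⊆p∪i (suc j) qj
  ... | inj₁ pj = pj
countF-≤-suc {suc n} {p} {q} (suc i) q⊆p∪i = ≤-trans
  (+-mono-≤ (indicator-mono head⊆) (countF-≤-suc i tail⊆))
  (≤-reflexive (+-suc _ _))
  where
  head⊆ : T (q zero) → T (p zero)
  head⊆ q0 with q⊆p∪i zero q0
  ... | inj₁ p0 = p0
  tail⊆ : ∀ j → T (q (suc j)) → T (p (suc j)) ⊎ j ≡ i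
  tail⊆ j qj with q⊆p∪i (suc j) qj
  ... | inj₁ pj = inj₁ pj
  ... | inj₂ j≡i = inj₂ (suc-injective j≡i)

countF-insert : ∀ {n} {p q : Fin n → Bool} (v : Fin n) → (∀ w → w ≢ v → p w ≡ q w) →
                p v ≡ false → q v ≡ true → countF q ≡ suc (countF p)
countF-insert {suc n} zero agree pv qv rewrite pv | qv =
  cong suc (≡.sym (countF-cong (λ w → agree (suc w) λ ())))
countF-insert {suc n} (suc v) agree pv qv = trans
  (cong₂ _+_ (cong indicator (≡.sym (agree zero λ ())))
             (countF-insert v (λ w w≢v → agree (suc w) (w≢v ∘ suc-injective)) pv qv))
  (+-suc _ _)

countF-partition : ∀ {n} (p s : Fin n → Bool) →
                   countF p ≡ countF (λ i → p i ∧ s i) + countF (λ i → p i ∧ not (s i))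
countF-partition {zero} p s = refl
countF-partition {suc n} p s = trans
  (cong₂ _+_ (indicator-split (p zero) (s zero)) (countF-partition (p ∘ suc) (s ∘ suc)))
  (interchange (indicator (p zero ∧ s zero)) (indicator (p zero ∧ not (s zero))) _ _)
  where
  indicator-split : ∀ a b → indicator a ≡ indicator (a ∧ b) + indicator (a ∧ not b)
  indicator-split false _ = refl
  indicator-split true true = refl
  indicator-split true false = refl

countF-true : ∀ {n} → countF {n} (λ _ → true) ≡ n
countF-true {zero} = refl
countF-true {suc n} = cong suc countF-true

countF-false : ∀ {n} {p : Fin n → Bool} → (∀ i → p i ≡ false) → countF p ≡ 0
countF-false {zero} _ = refl
countF-false {suc n} p≡false rewrite p≡false zero = countF-false (p≡false ∘ suc)

countF-≢0 : ∀ {n} {p : Fin n → Bool} → countF p ≢ 0 → ∃ λ i → p i ≡ true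
countF-≢0 {zero} count≢0 = ⊥-elim (count≢0 refl)
countF-≢0 {suc n} {p} count≢0 with p zero in p0
... | true = zero , p0
... | false with countF-≢0 {p = p ∘ suc} count≢0
...   | i , pi = suc i , pi

countF≡sum : ∀ {n} (p : Fin n → Bool) → countF p ≡ sum (indicator ∘ p)
countF≡sum {zero} p = refl
countF≡sum {suc n} p = cong (indicator (p zero) +_) (countF≡sum (p ∘ suc))

sum-const : ∀ n r → sum {n} (λ _ → r) ≡ n * r
sum-const zero r = refl
sum-const (suc n) r = cong (r +_) (sum-const n r)

parity-+-even : ∀ m n → parity m ≡ 0ℙ → parity (m + n) ≡ parity n
parity-+-even m n m-even = trans (+-homo-+ m n) (cong (ℙ._+ parity n) m-even)

parity-suc : ∀ m {p} → parity m ≡ p → parity (suc m) ≡ p ℙ.⁻¹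
parity-suc m m≡p = trans (+-homo-+ 1 m) (cong (1ℙ ℙ.+_) m≡p)

parity-%2≡1 : ∀ m → m % 2 ≡ 1 → parity m ≡ 1ℙ
parity-%2≡1 1             _      = refl
parity-%2≡1 (suc (suc m)) m%2≡1 = parity-%2≡1 m m%2≡1

odd≢even : ∀ {a b} → parity a ≡ 1ℙ → parity b ≡ 0ℙ → a ≢ b
odd≢even a-odd b-even refl = case trans (≡.sym a-odd) b-even of λ ()

parity-double : ∀ m → parity (m + m) ≡ 0ℙ
parity-double m = trans (+-homo-+ m m) (p+p≡0ℙ (parity m))

m+m≤n⇒m≤n/2 : ∀ {m n} → m + m ≤ n → m ≤ n / 2
m+m≤n⇒m≤n/2 {m} {n} m+m≤n = begin
  m              ≡⟨ m*n/n≡m m 2 ⟨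
  m * 2 / 2      ≤⟨ /-monoˡ-≤ 2 (≤-trans (≤-reflexive m*2≡m+m) m+m≤n) ⟩
  n / 2          ∎
  where
  open ≤-Reasoning
  m*2≡m+m : m * 2 ≡ m + m
  m*2≡m+m = trans (*-suc m 1) (cong (m +_) (*-identityʳ m))

minF-const : ∀ {n} {f : Fin (suc n) → ℕ} {r} → (∀ i → f i ≡ r) → minF f ≡ r
minF-const {zero} f≡r = f≡r zero
minF-const {suc n} {r = r} f≡r = trans (cong₂ _⊓_ (f≡r zero) (minF-const (f≡r ∘ suc))) (⊓-idem r)

removeFirst : ∀ {n} → Graph (suc n) → Graph n
removeFirst G = record
  { adj    = λ u v → adj G (suc u) (suc v)
  ; sym    = λ u v → Graph.sym G (suc u) (suc v)
  ; irrefl = irrefl G ∘ suc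
  }

handshake : ∀ {n} (G : Graph n) → parity (sum (degree G)) ≡ 0ℙ
handshake {zero} G = refl
handshake {suc n} G = begin
  parity (sum (degree G))  ≡⟨ cong parity degree-sum ⟩
  parity (d + (d + S))     ≡⟨ cong parity (+-assoc d d S) ⟨
  parity (d + d + S)       ≡⟨ parity-+-even (d + d) S (parity-double d) ⟩
  parity S                 ≡⟨ handshake (removeFirst G) ⟩
  0ℙ                       ∎
  where
  open ≡.≡-Reasoning
  d = countF (λ v → adj G zero (suc v))
  S = sum (degree (removeFirst G))
  degree-sum : sum (degree G) ≡ d + (d + S)
  degree-sum = cong₂ _+_ (cong (λ b → indicator b + d) (irrefl G zero)) (begin
    sum (λ v → indicator (adj G (suc v) zero) + degree (removeFirst G) v)
      ≡⟨ ∑-distrib-+ (λ v → indicator (adj G (suc v) zero)) (degree (removeFirst G)) ⟩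
    sum (λ v → indicator (adj G (suc v) zero)) + S
      ≡⟨ cong (_+ S) (countF≡sum (λ v → adj G (suc v) zero)) ⟨
    countF (λ v → adj G (suc v) zero) + S
      ≡⟨ cong (_+ S) (countF-cong (λ v → Graph.sym G (suc v) zero)) ⟩
    d + S ∎)

regular-odd⇒even-order : ∀ {n} (G : Graph n) {r} → Regular G r → parity r ≡ 1ℙ → parity n ≡ 0ℙ
regular-odd⇒even-order {n} G {r} regular r-odd = begin
  parity n                 ≡⟨ ℙ-*-identityʳ (parity n) ⟨
  parity n ℙ.* 1ℙ          ≡⟨ cong (parity n ℙ.*_) r-odd ⟨
  parity n ℙ.* parity r    ≡⟨ *-homo-* n r ⟨
  parity (n * r)           ≡⟨ cong parity (trans (sum-cong-≗ regular) (sum-const n r)) ⟨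
  parity (sum (degree G))  ≡⟨ handshake G ⟩
  0ℙ                       ∎
  where open ≡.≡-Reasoning

closedNbhd : ∀ {n} → Graph n → Fin n → Fin n → Bool
closedNbhd G x y = does (y ≟ x) ∨ adj G x y

module _ {n} (G : Graph n) (x : Fin n) where

  closedNbhd-self : closedNbhd G x x ≡ true
  closedNbhd-self with x ≟ x
  ... | yes _   = refl
  ... | no x≢x = ⊥-elim (x≢x refl)

  closedNbhd-∋ : ∀ {y} → y ≡ x ⊎ adj G x y ≡ true → closedNbhd G x y ≡ true
  closedNbhd-∋ (inj₁ refl) = closedNbhd-self
  closedNbhd-∋ {y} (inj₂ xy) rewrite xy = ∨-zeroʳ (does (y ≟ x))

  closedNbhd-size : countF (closedNbhd G x) ≡ suc (degree G x)
  closedNbhd-size = countF-insert x agree (irrefl G x) closedNbhd-self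
    where
    agree : ∀ y → y ≢ x → adj G x y ≡ closedNbhd G x y
    agree y y≢x with y ≟ x
    ... | yes y≡x = ⊥-elim (y≢x y≡x)
    ... | no _    = refl

assign-self : ∀ {n k} (c : Colouring n k) v i → assign c v i v ≡ just i
assign-self c v i with v ≟ v
... | yes _   = refl
... | no v≢v = ⊥-elim (v≢v refl)

assign-other : ∀ {n k} (c : Colouring n k) {v w} i → w ≢ v → assign c v i w ≡ c w
assign-other c {v} {w} i w≢v with w ≟ v
... | yes w≡v = ⊥-elim (w≢v w≡v)
... | no _    = refl

numColoured-assign : ∀ {n k} (c : Colouring n k) v i → c v ≡ nothing →
                     numColoured (assign c v i) ≡ suc (numColoured c)
numColoured-assign c v i cv = countF-insert v
  (λ w w≢v → cong is-just (≡.sym (assign-other c i w≢v)))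
  (cong is-just cv) (cong is-just (assign-self c v i))

aliceTurn⇒bobTurn : ∀ {n k} (c : Colouring n k) v i → c v ≡ nothing → AliceTurn c →
                    BobTurn (assign c v i)
aliceTurn⇒bobTurn c v i cv aliceTurn = begin
  numColoured (assign c v i) % 2           ≡⟨ cong (_% 2) (numColoured-assign c v i cv) ⟩
  (1 + numColoured c) % 2                  ≡⟨ %-distribˡ-+ 1 (numColoured c) 2 ⟩
  (1 % 2 + numColoured c % 2) % 2          ≡⟨ cong (λ m → (1 + m) % 2) aliceTurn ⟩
  1                                        ∎
  where open ≡.≡-Reasoning

colouredIn : ∀ {n k} → Colouring n k → (Fin n → Bool) → ℕ
colouredIn c S = countF (λ y → S y ∧ is-just (c y))

module _ {n k} (c : Colouring n k) (S : Fin n → Bool) where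

  colouredIn-assign-∈ : ∀ v i → S v ≡ true → c v ≡ nothing →
                        colouredIn (assign c v i) S ≡ suc (colouredIn c S)
  colouredIn-assign-∈ v i v∈S cv = countF-insert v
    (λ w w≢v → cong (λ m → S w ∧ is-just m) (≡.sym (assign-other c i w≢v)))
    (trans (cong (λ m → S v ∧ is-just m) cv) (∧-zeroʳ (S v)))
    (trans (cong (λ m → S v ∧ is-just m) (assign-self c v i)) (trans (∧-identityʳ (S v)) v∈S))

  colouredIn-assign-∉ : ∀ v i → S v ≡ false → colouredIn (assign c v i) S ≡ colouredIn c S
  colouredIn-assign-∉ v i v∉S = countF-cong agree
    where
    agree : ∀ w → S w ∧ is-just (assign c v i w) ≡ S w ∧ is-just (c w)
    agree w with w ≟ v
    ... | yes refl rewrite v∉S = refl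
    ... | no _     = refl

  colouredIn-complete : (∀ y → S y ≡ true → is-just (c y) ≡ true) → colouredIn c S ≡ countF S
  colouredIn-complete S⊆coloured = countF-cong agree
    where
    agree : ∀ y → S y ∧ is-just (c y) ≡ S y
    agree y with S y in y∈S
    ... | false = refl
    ... | true  = S⊆coloured y y∈S

  numColoured-partition : numColoured c ≡ colouredIn c S + colouredIn c (not ∘ S)
  numColoured-partition = trans (countF-partition (is-just ∘ c) S)
    (cong₂ _+_ (countF-cong (λ y → ∧-comm (is-just (c y)) (S y)))
               (countF-cong (λ y → ∧-comm (is-just (c y)) (not (S y)))))

  uncolouredIn : colouredIn c S ≢ countF S → ∃ λ v → S v ≡ true × c v ≡ nothing
  uncolouredIn coloured≢all with countF-≢0 {p = λ y → S y ∧ is-nothing (c y)} some-uncoloured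
    where
    some-uncoloured : countF (λ y → S y ∧ is-nothing (c y)) ≢ 0
    some-uncoloured none = coloured≢all (≡.sym (begin
      countF S
        ≡⟨ countF-partition S (is-just ∘ c) ⟩
      colouredIn c S + countF (λ y → S y ∧ is-nothing (c y))
        ≡⟨ cong (colouredIn c S +_) none ⟩
      colouredIn c S + 0   ≡⟨ +-identityʳ _ ⟩
      colouredIn c S       ∎))
      where open ≡.≡-Reasoning
  ... | v , _ with S v in v∈S | c v in cv
  ...   | true | nothing = v , v∈S , cv

module _ {n k} {G : Graph n} (Safe : Colouring n k → Set)
  (alice-keeps : ∀ {c} → AliceTurn c → Safe c → ∀ v → c v ≡ nothing → ∀ i → Safe (assign c v i))
  (bob-keeps : ∀ {c} → BobTurn c → Safe c → ∃ λ v → c v ≡ nothing × ∃ λ i → Safe (assign c v i))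
  where

  aliceWins⇒finalIn : ∀ {c} → AliceWins G k c → Safe c →
                      ∃ λ c′ → AllColoured c′ × AllClassesDominating G c′ × Safe c′
  aliceWins⇒finalIn (finished coloured dominating) safe = _ , coloured , dominating , safe
  aliceWins⇒finalIn (aliceMove turn v cv i wins) safe =
    aliceWins⇒finalIn wins (alice-keeps turn safe v cv i)
  aliceWins⇒finalIn (bobMove turn _ wins) safe with bob-keeps turn safe
  ... | v , cv , i , safe′ = aliceWins⇒finalIn (wins v cv i) safe′

-- Bob's strategy around a vertex of odd degree

module BobStrategy {n} (G : Graph n) (x : Fin n) {k : ℕ} where

  N[x] : Fin n → Bool
  N[x] = closedNbhd G x

  Seen : Colouring n k → Fin k → Set
  Seen c i = ∃ λ y → N[x] y ≡ true × c y ≡ just i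

  seen? : ∀ c → Decidable (Seen c)
  seen? c i = any? λ y → (N[x] y Bool.≟ true) ×-dec (≡-dec _≟_ (c y) (just i))

  coloursSeen : Colouring n k → ℕ
  coloursSeen c = countF (λ i → ⌊ seen? c i ⌋)

  seen-assign : ∀ {c v i j} → Seen (assign c v i) j → Seen c j ⊎ j ≡ i × N[x] v ≡ true
  seen-assign {v = v} (y , y∈N , cy) with y ≟ v
  ... | yes refl = inj₂ (just-injective (≡.sym cy) , y∈N)
  ... | no _     = inj₁ (y , y∈N , cy)

  coloursSeen-mono : ∀ {c c′} → (∀ j → Seen c′ j → Seen c j) → coloursSeen c′ ≤ coloursSeen c
  coloursSeen-mono seen′⊆seen = countF-mono λ j s → fromWitness (seen′⊆seen j (toWitness s))

  coloursSeen-assign : ∀ {c v} i → coloursSeen (assign c v i) ≤ suc (coloursSeen c)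
  coloursSeen-assign i =
    countF-≤-suc i λ j s → Sum.map fromWitness proj₁ (seen-assign (toWitness s))

  coloursSeen-assign-seen : ∀ {c v i} → Seen c i → coloursSeen (assign c v i) ≤ coloursSeen c
  coloursSeen-assign-seen seen-i = coloursSeen-mono λ j s → case seen-assign s of λ where
    (inj₁ seen-j)      → seen-j
    (inj₂ (refl , _)) → seen-i

  coloursSeen-assign-∉ : ∀ {c v i} → N[x] v ≡ false → coloursSeen (assign c v i) ≤ coloursSeen c
  coloursSeen-assign-∉ v∉N = coloursSeen-mono λ j s → case seen-assign s of λ where
    (inj₁ seen-j)     → seen-j
    (inj₂ (_ , v∈N)) → contradiction (trans (≡.sym v∈N) v∉N) λ ()

  coloursSeen-empty : coloursSeen emptyColouring ≡ 0
  coloursSeen-empty = countF-false unseen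
    where
    unseen : ∀ i → ⌊ seen? emptyColouring i ⌋ ≡ false
    unseen i with seen? emptyColouring i
    ... | no _ = refl

  dominating⇒coloursSeen : ∀ {c} → AllClassesDominating G c → k ≤ coloursSeen c
  dominating⇒coloursSeen {c} dominating = begin
    k                         ≡⟨ countF-true ⟨
    countF {k} (λ _ → true)   ≤⟨ countF-mono (λ i _ → fromWitness (seen i)) ⟩
    coloursSeen c             ∎
    where
    open ≤-Reasoning
    seen : ∀ i → Seen c i
    seen i with dominating x i
    ... | y , y∈N , cy = y , closedNbhd-∋ G x y∈N , cy

  coloured⇒seen : ∀ {c} → colouredIn c N[x] ≢ 0 → ∃ (Seen c)
  coloured⇒seen {c} coloured≢0 with countF-≢0 coloured≢0
  ... | y , _ with N[x] y in y∈N | c y in cy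
  ...   | true | just j = j , y , y∈N , cy

  data Balanced (c : Colouring n k) : Set where
    even-balanced : parity (colouredIn c N[x]) ≡ 0ℙ →
                    coloursSeen c + coloursSeen c ≤ colouredIn c N[x] → Balanced c
    odd-balanced  : BobTurn c → parity (colouredIn c N[x]) ≡ 1ℙ →
                    coloursSeen c + coloursSeen c ≤ suc (colouredIn c N[x]) → Balanced c

  balanced-empty : Balanced emptyColouring
  balanced-empty = even-balanced (cong parity nothing-coloured)
    (≤-reflexive (trans (cong₂ _+_ coloursSeen-empty coloursSeen-empty) (≡.sym nothing-coloured)))
    where
    nothing-coloured : colouredIn (emptyColouring {k = k}) N[x] ≡ 0
    nothing-coloured = countF-false λ y → ∧-zeroʳ (N[x] y)

  module _ {c : Colouring n k} {v : Fin n} (i : Fin k) where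

    move-outside : parity (colouredIn c N[x]) ≡ 0ℙ →
                   coloursSeen c + coloursSeen c ≤ colouredIn c N[x] →
                   N[x] v ≡ false → Balanced (assign c v i)
    move-outside even bound v∉N = even-balanced
      (trans (cong parity (colouredIn-assign-∉ c N[x] v i v∉N)) even)
      (begin
        coloursSeen (assign c v i) + coloursSeen (assign c v i)
          ≤⟨ +-mono-≤ (coloursSeen-assign-∉ v∉N) (coloursSeen-assign-∉ v∉N) ⟩
        coloursSeen c + coloursSeen c    ≤⟨ bound ⟩
        colouredIn c N[x]                ≡⟨ colouredIn-assign-∉ c N[x] v i v∉N ⟨
        colouredIn (assign c v i) N[x]   ∎)
      where open ≤-Reasoning

    move-inside-fresh : AliceTurn c → c v ≡ nothing → parity (colouredIn c N[x]) ≡ 0ℙ →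
                        coloursSeen c + coloursSeen c ≤ colouredIn c N[x] →
                        N[x] v ≡ true → Balanced (assign c v i)
    move-inside-fresh turn cv even bound v∈N = odd-balanced (aliceTurn⇒bobTurn c v i cv turn)
      (trans (cong parity one-more) (parity-suc (colouredIn c N[x]) even))
      (begin
        coloursSeen (assign c v i) + coloursSeen (assign c v i)
          ≤⟨ +-mono-≤ (coloursSeen-assign i) (coloursSeen-assign i) ⟩
        suc (coloursSeen c) + suc (coloursSeen c)   ≡⟨ cong suc (+-suc _ _) ⟩
        suc (suc (coloursSeen c + coloursSeen c))   ≤⟨ s≤s (s≤s bound) ⟩
        suc (suc (colouredIn c N[x]))               ≡⟨ cong suc one-more ⟨
        suc (colouredIn (assign c v i) N[x])        ∎)
      where
      open ≤-Reasoning
      one-more = colouredIn-assign-∈ c N[x] v i v∈N cv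

    move-inside-seen : c v ≡ nothing → parity (colouredIn c N[x]) ≡ 1ℙ →
                       coloursSeen c + coloursSeen c ≤ suc (colouredIn c N[x]) →
                       N[x] v ≡ true → Seen c i → Balanced (assign c v i)
    move-inside-seen cv odd bound v∈N seen-i = even-balanced
      (trans (cong parity one-more) (parity-suc (colouredIn c N[x]) odd))
      (begin
        coloursSeen (assign c v i) + coloursSeen (assign c v i)
          ≤⟨ +-mono-≤ (coloursSeen-assign-seen seen-i) (coloursSeen-assign-seen seen-i) ⟩
        coloursSeen c + coloursSeen c    ≤⟨ bound ⟩
        suc (colouredIn c N[x])          ≡⟨ one-more ⟨
        colouredIn (assign c v i) N[x]   ∎)
      where
      open ≤-Reasoning
      one-more = colouredIn-assign-∈ c N[x] v i v∈N cv

  alice-keeps : ∀ {c} → AliceTurn c → Balanced c →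
                ∀ v → c v ≡ nothing → ∀ i → Balanced (assign c v i)
  alice-keeps turn (odd-balanced bobTurn _ _) _ _ _ =
    contradiction (trans (≡.sym turn) bobTurn) λ ()
  alice-keeps turn (even-balanced even bound) v cv i with N[x] v in v∈N?
  ... | true  = move-inside-fresh i turn cv even bound v∈N?
  ... | false = move-outside i even bound v∈N?

  module _ (order-even : parity n ≡ 0ℙ) (degree-odd : parity (degree G x) ≡ 1ℙ) where

    N[x]-even : parity (countF N[x]) ≡ 0ℙ
    N[x]-even = trans (cong parity (closedNbhd-size G x)) (parity-suc (degree G x) degree-odd)

    outside-even : parity (countF (not ∘ N[x])) ≡ 0ℙ
    outside-even = begin
      parity (countF (not ∘ N[x]))
        ≡⟨ parity-+-even (countF N[x]) (countF (not ∘ N[x])) N[x]-even ⟨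
      parity (countF N[x] + countF (not ∘ N[x]))
        ≡⟨ cong parity (countF-partition (λ _ → true) N[x]) ⟨
      parity (countF {n} (λ _ → true))   ≡⟨ cong parity (countF-true {n}) ⟩
      parity n                           ≡⟨ order-even ⟩
      0ℙ                                 ∎
      where open ≡.≡-Reasoning

    bob-keeps : Fin k → ∀ {c} → BobTurn c → Balanced c →
                ∃ λ v → c v ≡ nothing × ∃ λ i → Balanced (assign c v i)
    bob-keeps i₀ {c} turn (even-balanced even bound)
      with uncolouredIn c (not ∘ N[x]) (odd≢even outside-odd outside-even)
      where
      outside-odd : parity (colouredIn c (not ∘ N[x])) ≡ 1ℙ
      outside-odd = begin
        parity (colouredIn c (not ∘ N[x]))
          ≡⟨ parity-+-even (colouredIn c N[x]) (colouredIn c (not ∘ N[x])) even ⟨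
        parity (colouredIn c N[x] + colouredIn c (not ∘ N[x]))
          ≡⟨ cong parity (numColoured-partition c N[x]) ⟨
        parity (numColoured c)   ≡⟨ parity-%2≡1 (numColoured c) turn ⟩
        1ℙ                       ∎
        where open ≡.≡-Reasoning
    ... | v , v∉N , cv = v , cv , i₀ , move-outside i₀ even bound (not-injective v∉N)
    bob-keeps i₀ {c} turn (odd-balanced _ odd bound)
      with uncolouredIn c N[x] (odd≢even odd N[x]-even) | coloured⇒seen (odd≢even odd refl)
    ... | v , v∈N , cv | j , seen-j = v , cv , j , move-inside-seen j cv odd bound v∈N seen-j

    finished⇒k+k≤1+degree : ∀ {c} → AllColoured c → AllClassesDominating G c → Balanced c →
                            k + k ≤ suc (degree G x)
    finished⇒k+k≤1+degree {c} coloured dominating (odd-balanced _ odd _) =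
      contradiction (colouredIn-complete c N[x] λ y _ → coloured y) (odd≢even odd N[x]-even)
    finished⇒k+k≤1+degree {c} coloured dominating (even-balanced _ bound) = begin
      k + k                           ≤⟨ +-mono-≤ k≤seen k≤seen ⟩
      coloursSeen c + coloursSeen c   ≤⟨ bound ⟩
      colouredIn c N[x]               ≡⟨ colouredIn-complete c N[x] (λ y _ → coloured y) ⟩
      countF N[x]                     ≡⟨ closedNbhd-size G x ⟩
      suc (degree G x)                ∎
      where
      open ≤-Reasoning
      k≤seen = dominating⇒coloursSeen dominating

    aliceWins⇒k+k≤1+degree : Fin k → AliceWinsAGame G k → k + k ≤ suc (degree G x)
    aliceWins⇒k+k≤1+degree i₀ wins
      with aliceWins⇒finalIn Balanced alice-keeps (bob-keeps i₀) wins balanced-empty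
    ... | _ , coloured , dominating , balanced =
      finished⇒k+k≤1+degree coloured dominating balanced

aliceWins⇒k+k≤1+degree : ∀ {n} (G : Graph n) (x : Fin n) →
                         parity n ≡ 0ℙ → parity (degree G x) ≡ 1ℙ →
                         ∀ k → AliceWinsAGame G k → k + k ≤ suc (degree G x)
aliceWins⇒k+k≤1+degree G x order-even degree-odd zero    _    = z≤n
aliceWins⇒k+k≤1+degree G x order-even degree-odd (suc k) wins =
  BobStrategy.aliceWins⇒k+k≤1+degree G x order-even degree-odd zero wins

corollary4p3 : ∀ {n} (G : Graph (suc n)) (r : ℕ) → Regular G r → r % 2 ≡ 1 →
                 ∀ (k : ℕ) → AliceWinsAGame G k → k ≤ (minDegree G + 1) / 2
corollary4p3 G r regular r%2≡1 k wins = begin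
  k                         ≤⟨ m+m≤n⇒m≤n/2 k+k≤1+r ⟩
  suc r / 2                 ≡⟨ cong (_/ 2) (+-comm 1 r) ⟩
  (r + 1) / 2               ≡⟨ cong (λ d → (d + 1) / 2) (minF-const regular) ⟨
  (minDegree G + 1) / 2     ∎
  where
  open ≤-Reasoning
  r-odd : parity r ≡ 1ℙ
  r-odd = parity-%2≡1 r r%2≡1
  order-even = regular-odd⇒even-order G regular r-odd
  degree-odd = trans (cong parity (regular zero)) r-odd
  k+k≤1+r : k + k ≤ suc r
  k+k≤1+r = ≤-trans (aliceWins⇒k+k≤1+degree G zero order-even degree-odd k wins)
                    (≤-reflexive (cong suc (regular zero)))
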